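{- Let $N \ge 2$ be an integer, and let $p_{\max}^d$ (with $p_{\max}$ prime, $d \geq 1$) be the largest prime power $\leq N$. Suppose there is a prime $p_0 \neq p_{\max}$ not dividing $N$ such that the base-$p_0$ expansion of $N$ has digit-sum at most $5$, and suppose that for all primes $p$ dividing $N$, and also for $p = p_0$, the $p$-threshold of $N$ with respect to $k = 3$ is less than $p_{\max}^d$. Then there do not exist three decompositions of $N$ as sums of three positive integers such that for every prime $p$ at least one of the three decompositions is $p$-acceptable; equivalently, any three trinomial coefficients $N!/(x_1!x_2!x_3!)$ with $x_1,x_2,x_3$ positive integers summing to $N$ have a common divisor greater than $1$.
   Context: For a prime $p$, a decomposition $N = c_1 + \dots + c_k$ of a positive integer $N$ as a sum of positive integers is called $p$-acceptable if the multinomial coefficient $N!/(c_1!\cdots c_k!)$ is not divisible by $p$; equivalently, for each $t\ge 0$, the coefficient of $p^t$ in the base-$p$ expansion of $N$ equals the sum of the coefficients of $p^t$ in the base-$p$ expansions of $c_1,\dots,c_k$ (no carrying in base $p$). If the base-$p$ digit-sum of $N$ is at least $k$, the $p$-threshold of $N$ with respect to $k$ is the greatest integer occurring as a summand in any $p$-acceptable expression of $N$ as a sum of $k$ positive integers (the hypothesis on thresholds includes that these are defined, i.e. the relevant digit-sums are at least $3$). -}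

module Defs where

open import Data.Nat.Base
open import Data.Nat.Properties using (m*n≢0; _!≢0)
open import Data.Nat.Divisibility using (_∣_)
open import Data.Nat.Primality using (Prime)
open import Data.Vec.Base using (Vec; []; _∷_; sum)
open import Data.Vec.Relation.Unary.All using (All)
open import Data.Vec.Membership.Propositional using (_∈_)
open import Data.Product using (_×_; ∃; ∃-syntax)
open import Relation.Nullary using (¬_)
open import Relation.Binary.PropositionalEquality using (_≡_)

digitSumAux : ℕ → (b : ℕ) → .{{NonZero b}} → ℕ → ℕ
digitSumAux zero       b n = 0
digitSumAux (suc fuel) b n = n % b + digitSumAux fuel b (n / b)

-- Base-b digit sum of n (for b ≥ 2; n steps always suffice).
-- For b ∈ {0,1} (never used) it returns n.
digitSum : ℕ → ℕ → ℕ
digitSum zero          n = n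
digitSum (suc zero)    n = n
digitSum (suc (suc b)) n = digitSumAux n (suc (suc b)) n

prodFact : ∀ {k} → Vec ℕ k → ℕ
prodFact [] = 1
prodFact (c ∷ cs) = c ! * prodFact cs

prodFact≢0 : ∀ {k} (cs : Vec ℕ k) → NonZero (prodFact cs)
prodFact≢0 [] = _
prodFact≢0 (c ∷ cs) = m*n≢0 (c !) (prodFact cs) {{c !≢0}} {{prodFact≢0 cs}}

multinomial : ℕ → ∀ {k} → Vec ℕ k → ℕ
multinomial N cs = (N ! / prodFact cs) {{prodFact≢0 cs}}

IsDecomposition : ℕ → ∀ {k} → Vec ℕ k → Set
IsDecomposition N cs = All (λ c → 1 ≤ c) cs × sum cs ≡ N

Acceptable : ℕ → ℕ → ∀ {k} → Vec ℕ k → Set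
Acceptable p N cs = ¬ (p ∣ multinomial N cs)

IsThreshold : ℕ → ℕ → ℕ → ℕ → Set
IsThreshold p N k t =
  (∃[ cs ] (IsDecomposition N {k} cs × Acceptable p N cs × t ∈ cs)) ×
  (∀ (cs : Vec ℕ k) → IsDecomposition N cs → Acceptable p N cs → ∀ c → c ∈ cs → c ≤ t)

IsPrimePower : ℕ → Set
IsPrimePower q = ∃[ r ] ∃[ e ] (Prime r × 1 ≤ e × q ≡ r ^ e)

{-# OPTIONS --safe #-}
-- Write vₚ(n!) = Σᵢ ⌊n/pⁱ⌋ (Legendre) and sₚ for the base-p digit sum, so that (p − 1)·vₚ(n!) + sₚ(n) = n.
-- A decomposition of N is p-acceptable exactly when vₚ(N!) is the sum of the vₚ(c!) over its parts,
-- and then sₚ is additive over the parts as well.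
-- (1) If all parts are below pₘᵈ ≤ N, the term ⌊·/pₘᵈ⌋ breaks this additivity; since the thresholds put
--     the parts of any decomposition acceptable for p₀ or a prime divisor of N below pₘᵈ, such a
--     decomposition is not pₘ-acceptable.
-- (2) For every part c, N divides c·N!/∏c!; so a q-acceptable decomposition with q ∣ N has all parts
--     divisible by q, and no decomposition is acceptable for every prime divisor of N (N would divide
--     a part c < N).
-- (3) The p₀-digit sums of the three parts of a p₀-acceptable decomposition add up to at most 5, so some
--     part is a power of p₀, which no prime divisor of N divides since p₀ ∤ N.
-- Hence the decompositions covering p₀ and pₘ differ and cover no prime divisor of N, and the third
-- decomposition cannot cover them all.
module Submission where

open import Defs
open import Data.Nat.Base
open import Data.Nat.Properties
open import Data.Nat.DivMod
open import Data.Nat.Divisibility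
open import Data.Nat.Primality
open import Data.Nat.Combinatorics using (k![n∸k]!∣n!)
open import Data.Nat.Tactic.RingSolver using (solve-∀)
open import Data.Vec.Base using (Vec; []; _∷_; sum; map)
open import Data.Vec.Relation.Unary.All as All using (All; []; _∷_)
open import Data.Vec.Relation.Unary.All.Properties using (map⁺; lookup⁻)
open import Data.Vec.Membership.Propositional using (_∈_)
open import Data.Vec.Membership.Propositional.Properties using (∈-lookup)
open import Data.Vec.Relation.Unary.Any using (Any; here; there)
open import Data.Vec.Relation.Unary.Any.Properties as Any using ()
open import Data.List.Base using ([]; _∷_)
open import Data.Nat.ListAction using (product)
open import Data.List.Relation.Unary.All using (_∷_)
open import Data.Nat.Primality.Factorisation using (factorise)
open import Data.Nat.Coprimality using (Coprime; coprime-divisor)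
open import Data.Product using (_×_; _,_; ∃; ∃-syntax; proj₂)
open import Data.Sum using (_⊎_; inj₁; inj₂; [_,_]′; fromInj₁; fromInj₂; map₂)
open import Relation.Nullary using (¬_; yes; no; contradiction)
open import Relation.Binary.PropositionalEquality

record ExactPower (p e m : ℕ) : Set where
  constructor exactPower
  field
    cofactor      : ℕ
    p∤cofactor    : ¬ p ∣ cofactor
    factorisation : m ≡ p ^ e * cofactor

exactPower-unique : ∀ {p e e′ m} .{{_ : NonZero p}} →
                    ExactPower p e m → ExactPower p e′ m → e ≡ e′
exactPower-unique {p} (exactPower u p∤u m≡) (exactPower v p∤v m≡′) = cancel _ _ p∤u p∤v (trans (sym m≡) m≡′)
  where
  p∣p^[1+e]* : ∀ e w → p ∣ p ^ suc e * w
  p∣p^[1+e]* e w = ∣m⇒∣m*n w (m∣m*n (p ^ e))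
  cancel : ∀ e e′ {u v} → ¬ p ∣ u → ¬ p ∣ v → p ^ e * u ≡ p ^ e′ * v → e ≡ e′
  cancel zero    zero     _   _   _  = refl
  cancel zero    (suc e′) p∤u _   eq = contradiction (subst (p ∣_) (trans (sym eq) (*-identityˡ _)) (p∣p^[1+e]* e′ _)) p∤u
  cancel (suc e) zero     _   p∤v eq = contradiction (subst (p ∣_) (trans eq (*-identityˡ _)) (p∣p^[1+e]* e _)) p∤v
  cancel (suc e) (suc e′) p∤u p∤v eq = cong suc (cancel e e′ p∤u p∤v (*-cancelˡ-≡ _ _ p
    (trans (sym (*-assoc p (p ^ e) _)) (trans eq (*-assoc p (p ^ e′) _)))))

prime∤* : ∀ {p m n} → Prime p → ¬ p ∣ m → ¬ p ∣ n → ¬ p ∣ m * n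
prime∤* p-prime p∤m p∤n p∣mn = [ p∤m , p∤n ]′ (euclidsLemma _ _ p-prime p∣mn)

exactPower-* : ∀ {p e e′ m n} → Prime p →
               ExactPower p e m → ExactPower p e′ n → ExactPower p (e + e′) (m * n)
exactPower-* {p} {e} {e′} {m} {n} p-prime (exactPower u p∤u m≡) (exactPower v p∤v n≡) =
  exactPower (u * v) (prime∤* p-prime p∤u p∤v) (begin
    m * n                       ≡⟨ cong₂ _*_ m≡ n≡ ⟩
    p ^ e * u * (p ^ e′ * v)    ≡⟨ interchange (p ^ e) u (p ^ e′) v ⟩
    p ^ e * p ^ e′ * (u * v)    ≡⟨ cong (_* (u * v)) (^-distribˡ-+-* p e e′) ⟨
    p ^ (e + e′) * (u * v)      ∎)
  where
  open ≡-Reasoning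
  interchange : ∀ a b c d → a * b * (c * d) ≡ a * c * (b * d)
  interchange = solve-∀

exactPower-*-unit : ∀ {p e m w} → Prime p → ExactPower p e m → ¬ p ∣ w → ExactPower p e (m * w)
exactPower-*-unit {p} {e} {w = w} p-prime (exactPower u p∤u m≡) p∤w =
  exactPower (u * w) (prime∤* p-prime p∤u p∤w) (trans (cong (_* w) m≡) (*-assoc (p ^ e) u w))

exactPower-p^* : ∀ {p e m} f → ExactPower p e m → ExactPower p (f + e) (p ^ f * m)
exactPower-p^* {p} {e} f (exactPower u p∤u m≡) =
  exactPower u p∤u (trans (cong (p ^ f *_) m≡)
                  (trans (sym (*-assoc (p ^ f) (p ^ e) u)) (cong (_* u) (sym (^-distribˡ-+-* p f e)))))

m/n+o/n≤[m+o]/n : ∀ m o n .{{_ : NonZero n}} → m / n + o / n ≤ (m + o) / n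
m/n+o/n≤[m+o]/n m o n = begin
  m / n + o / n                ≡⟨ m*n/n≡m (m / n + o / n) n ⟨
  (m / n + o / n) * n / n      ≤⟨ /-monoˡ-≤ n (begin
    (m / n + o / n) * n          ≡⟨ *-distribʳ-+ n (m / n) (o / n) ⟩
    m / n * n + o / n * n        ≤⟨ +-mono-≤ (m/n*n≤m m n) (m/n*n≤m o n) ⟩
    m + o                        ∎) ⟩
  (m + o) / n                  ∎
  where open ≤-Reasoning

digitSum≡digitSumAux : ∀ p .{{_ : NonTrivial p}} n →
                       digitSum p n ≡ digitSumAux n p {{nonTrivial⇒nonZero p}} n
digitSum≡digitSumAux (2+ b) n = refl

module Legendre (p : ℕ) .{{_ : NonTrivial p}} where

  private instance
    p-nonZero : NonZero p
    p-nonZero = nonTrivial⇒nonZero p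

  -- legendreAux k n = ⌊n/p⌋ + ⌊n/p²⌋ + ⋯ + ⌊n/pᵏ⌋, which is complete once n ≤ k.
  legendreAux : ℕ → ℕ → ℕ
  legendreAux zero    n = 0
  legendreAux (suc k) n = n / p + legendreAux k (n / p)

  legendre : ℕ → ℕ
  legendre n = legendreAux n n

  /p≤ : ∀ {n k} → n ≤ suc k → n / p ≤ k
  /p≤ {zero}  _         = ≤-trans (≤-reflexive (0/n≡0 p)) z≤n
  /p≤ {suc n} 1+n≤1+k   = ≤-pred (<-≤-trans (m/n<m (suc n) p (nonTrivial⇒n>1 p)) 1+n≤1+k)

  legendreAux-0 : ∀ k → legendreAux k 0 ≡ 0
  legendreAux-0 zero    = refl
  legendreAux-0 (suc k) = trans (cong (λ m → m + legendreAux k m) (0/n≡0 p)) (legendreAux-0 k)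

  legendreAux-fuel : ∀ {n k k′} → n ≤ k → n ≤ k′ → legendreAux k n ≡ legendreAux k′ n
  legendreAux-fuel {k = zero}  {zero}   _ _ = refl
  legendreAux-fuel {k = zero}  {suc k′} z≤n _ = sym (legendreAux-0 (suc k′))
  legendreAux-fuel {k = suc k} {zero}   _ z≤n = legendreAux-0 (suc k)
  legendreAux-fuel {n} {suc k} {suc k′} n≤k n≤k′ =
    cong (n / p +_) (legendreAux-fuel (/p≤ n≤k) (/p≤ n≤k′))

  legendre-unfold : ∀ n → legendre n ≡ n / p + legendre (n / p)
  legendre-unfold zero    = cong (λ m → m + legendre m) (sym (0/n≡0 p))
  legendre-unfold (suc n) = cong (suc n / p +_) (legendreAux-fuel (/p≤ ≤-refl) ≤-refl)

  legendreAux-digitSumAux : ∀ {n k} → n ≤ k → (p ∸ 1) * legendreAux k n + digitSumAux k p n ≡ n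
  legendreAux-digitSumAux {k = zero} z≤n = trans (+-identityʳ _) (*-zeroʳ (p ∸ 1))
  legendreAux-digitSumAux {n} {suc k} n≤k = begin
    (p ∸ 1) * (n / p + L) + (n % p + s)   ≡⟨ regroup (p ∸ 1) (n / p) L (n % p) s ⟩
    n % p + ((p ∸ 1) * (n / p) + ((p ∸ 1) * L + s))
      ≡⟨ cong (λ t → n % p + ((p ∸ 1) * (n / p) + t)) (legendreAux-digitSumAux (/p≤ n≤k)) ⟩
    n % p + ((p ∸ 1) * (n / p) + n / p)   ≡⟨ cong (n % p +_) (fold (p ∸ 1) (n / p)) ⟩
    n % p + (1 + (p ∸ 1)) * (n / p)       ≡⟨ cong (λ t → n % p + t * (n / p)) (m+[n∸m]≡n (>-nonZero⁻¹ p)) ⟩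
    n % p + p * (n / p)                   ≡⟨ cong (n % p +_) (*-comm p (n / p)) ⟩
    n % p + n / p * p                     ≡⟨ m≡m%n+[m/n]*n n p ⟨
    n                                     ∎
    where
    open ≡-Reasoning
    L = legendreAux k (n / p)
    s = digitSumAux k p (n / p)
    regroup : ∀ a q l r s → a * (q + l) + (r + s) ≡ r + (a * q + (a * l + s))
    regroup = solve-∀
    fold : ∀ a q → a * q + q ≡ (1 + a) * q
    fold = solve-∀

  legendre-digitSum : ∀ n → (p ∸ 1) * legendre n + digitSum p n ≡ n
  legendre-digitSum n rewrite digitSum≡digitSumAux p n = legendreAux-digitSumAux ≤-refl

  digitSumAux≡0⇒≡0 : ∀ {n k} → n ≤ k → digitSumAux k p n ≡ 0 → n ≡ 0
  digitSumAux≡0⇒≡0 {k = zero} z≤n _ = refl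
  digitSumAux≡0⇒≡0 {n} {suc k} n≤k s≡0 = begin
    n                 ≡⟨ m≡m%n+[m/n]*n n p ⟩
    n % p + n / p * p ≡⟨ cong₂ (λ r q → r + q * p) (m+n≡0⇒m≡0 (n % p) s≡0)
                          (digitSumAux≡0⇒≡0 (/p≤ n≤k) (m+n≡0⇒n≡0 (n % p) s≡0)) ⟩
    0                 ∎
    where open ≡-Reasoning

  digitSum-pos : ∀ {n} → 1 ≤ n → 1 ≤ digitSum p n
  digitSum-pos {n} 1≤n = n≢0⇒n>0 λ s≡0 →
    <⇒≢ 1≤n (sym (digitSumAux≡0⇒≡0 ≤-refl (trans (sym (digitSum≡digitSumAux p n)) s≡0)))

  digitSumAux≡1⇒power : ∀ {n k} → n ≤ k → digitSumAux k p n ≡ 1 → ∃[ j ] n ≡ p ^ j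
  digitSumAux≡1⇒power {k = zero} z≤n ()
  digitSumAux≡1⇒power {n} {suc k} n≤k = byLastDigit (n % p) refl
    where
    n≡ : ∀ {r} → n % p ≡ r → n ≡ r + n / p * p
    n≡ r≡ = trans (m≡m%n+[m/n]*n n p) (cong (_+ n / p * p) r≡)
    byLastDigit : ∀ r → n % p ≡ r → r + digitSumAux k p (n / p) ≡ 1 → ∃[ j ] n ≡ p ^ j
    byLastDigit 0 r≡ s≡1 with digitSumAux≡1⇒power (/p≤ n≤k) s≡1
    ... | j , q≡ = suc j , trans (n≡ r≡) (trans (cong (_* p) q≡) (*-comm (p ^ j) p))
    byLastDigit 1 r≡ s≡1 =
      0 , trans (n≡ r≡) (cong (λ q → 1 + q * p) (digitSumAux≡0⇒≡0 (/p≤ n≤k) (suc-injective s≡1)))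
    byLastDigit (2+ _) _ ()

  digitSum≡1⇒power : ∀ {n} → digitSum p n ≡ 1 → ∃[ j ] n ≡ p ^ j
  digitSum≡1⇒power {n} s≡1 = digitSumAux≡1⇒power ≤-refl (trans (sym (digitSum≡digitSumAux p n)) s≡1)

  sum≡legendre+digitSum : ∀ {k} (cs : Vec ℕ k) →
    sum cs ≡ (p ∸ 1) * sum (map legendre cs) + sum (map (digitSum p) cs)
  sum≡legendre+digitSum []       = sym (trans (+-identityʳ _) (*-zeroʳ (p ∸ 1)))
  sum≡legendre+digitSum (c ∷ cs) = begin
    c + sum cs
      ≡⟨ cong₂ _+_ (sym (legendre-digitSum c)) (sum≡legendre+digitSum cs) ⟩
    ((p ∸ 1) * legendre c + digitSum p c) + ((p ∸ 1) * sum (map legendre cs) + sum (map (digitSum p) cs))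
      ≡⟨ regroup (p ∸ 1) (legendre c) (digitSum p c) (sum (map legendre cs)) (sum (map (digitSum p) cs)) ⟩
    (p ∸ 1) * (legendre c + sum (map legendre cs)) + (digitSum p c + sum (map (digitSum p) cs)) ∎
    where
    open ≡-Reasoning
    regroup : ∀ a l s l′ s′ → (a * l + s) + (a * l′ + s′) ≡ a * (l + l′) + (s + s′)
    regroup = solve-∀

  sum-map-/ : ∀ {k} (cs : Vec ℕ k) → sum (map (_/ p) cs) ≤ sum cs / p
  sum-map-/ []       = ≤-reflexive (sym (0/n≡0 p))
  sum-map-/ (c ∷ cs) = ≤-trans (+-monoʳ-≤ (c / p) (sum-map-/ cs)) (m/n+o/n≤[m+o]/n c (sum cs) p)

  sum-map-legendre : ∀ {k} (cs : Vec ℕ k) →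
    sum (map legendre cs) ≡ sum (map (_/ p) cs) + sum (map legendre (map (_/ p) cs))
  sum-map-legendre []       = refl
  sum-map-legendre (c ∷ cs) =
    trans (cong₂ _+_ (legendre-unfold c) (sum-map-legendre cs))
          (interchange (c / p) (legendre (c / p)) (sum (map (_/ p) cs)) (sum (map legendre (map (_/ p) cs))))
    where
    interchange : ∀ a b c d → (a + b) + (c + d) ≡ (a + c) + (b + d)
    interchange = solve-∀

  sum-map-legendre≡0 : ∀ {k} {cs : Vec ℕ k} → All (_< p) cs → sum (map legendre cs) ≡ 0
  sum-map-legendre≡0 []             = refl
  sum-map-legendre≡0 {cs = c ∷ cs} (c<p ∷ cs<p) = begin
    legendre c + sum (map legendre cs)  ≡⟨ cong₂ _+_ (legendre-unfold c) (sum-map-legendre≡0 cs<p) ⟩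
    c / p + legendre (c / p) + 0        ≡⟨ cong (λ q → q + legendre q + 0) (m<n⇒m/n≡0 c<p) ⟩
    0                                   ∎
    where open ≡-Reasoning

  -- The term ⌊·/pᵉ⁺¹⌋ vanishes on every part but not on n; all other terms are superadditive.
  legendre-superadditive-strict : ∀ e {n k} (cs : Vec ℕ k) → All (_< p ^ suc e) cs →
    p ^ suc e ≤ n → sum cs ≤ n → sum (map legendre cs) < legendre n
  legendre-superadditive-strict zero {n} cs cs<p p≤n _ = begin-strict
    sum (map legendre cs)     ≡⟨ sum-map-legendre≡0 (All.map (subst (_ <_) (*-identityʳ p)) cs<p) ⟩
    0                         <⟨ m≥n⇒m/n>0 (subst (_≤ n) (*-identityʳ p) p≤n) ⟩
    n / p                     ≤⟨ m≤m+n (n / p) _ ⟩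
    n / p + legendre (n / p)  ≡⟨ legendre-unfold n ⟨
    legendre n                ∎
    where open ≤-Reasoning
  legendre-superadditive-strict (suc e) {n} cs cs< p^e≤n Σ≤n = begin-strict
    sum (map legendre cs)
      ≡⟨ sum-map-legendre cs ⟩
    sum (map (_/ p) cs) + sum (map legendre (map (_/ p) cs))
      <⟨ +-mono-≤-< Σ/p≤n/p (legendre-superadditive-strict e (map (_/ p) cs)
           (map⁺ (All.map shrink cs<)) p^e≤n/p Σ/p≤n/p) ⟩
    n / p + legendre (n / p)
      ≡⟨ legendre-unfold n ⟨
    legendre n ∎
    where
    open ≤-Reasoning
    shrink : ∀ {c} → c < p ^ suc (suc e) → c / p < p ^ suc e
    shrink {c} c< = m<n*o⇒m/o<n (subst (c <_) (*-comm p (p ^ suc e)) c<)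
    Σ/p≤n/p : sum (map (_/ p) cs) ≤ n / p
    Σ/p≤n/p = ≤-trans (sum-map-/ cs) (/-monoˡ-≤ p Σ≤n)
    p^e≤n/p : p ^ suc e ≤ n / p
    p^e≤n/p = subst (_≤ n / p) (m*n/n≡m (p ^ suc e) p)
                (/-monoˡ-≤ p (subst (_≤ n) (*-comm p (p ^ suc e)) p^e≤n))

m!*n!∣[m+n]! : ∀ m n → m ! * n ! ∣ (m + n) !
m!*n!∣[m+n]! m n = subst (λ k → m ! * k ! ∣ (m + n) !) (m+n∸m≡n m n) (k![n∸k]!∣n! (m≤m+n m n))

prodFact∣sum! : ∀ {k} (cs : Vec ℕ k) → prodFact cs ∣ sum cs !
prodFact∣sum! []       = ∣-refl
prodFact∣sum! (c ∷ cs) = ∣-trans (*-monoʳ-∣ (c !) (prodFact∣sum! cs)) (m!*n!∣[m+n]! c (sum cs))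

multinomial*prodFact : ∀ {N k} (cs : Vec ℕ k) → sum cs ≡ N → multinomial N cs * prodFact cs ≡ N !
multinomial*prodFact cs refl = m/n*n≡m {{prodFact≢0 cs}} (prodFact∣sum! cs)

-- c · N!/(c! r!) = N · (N − 1)!/((c − 1)! r!)
sum∣head*cofactor : ∀ {k c} (cs : Vec ℕ k) {F} → 1 ≤ c →
                    F * prodFact (c ∷ cs) ≡ (c + sum cs) ! → c + sum cs ∣ c * F
sum∣head*cofactor {c = suc x} cs {F} _ F*Π≡ with prodFact∣sum! (x ∷ cs)
... | divides m [x+Σ]!≡ = divides m (*-cancelʳ-≡ (suc x * F) (m * suc (x + sum cs)) D {{prodFact≢0 (x ∷ cs)}} (begin
  suc x * F * D                        ≡⟨ regroup (suc x) F (x !) (prodFact cs) ⟩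
  F * prodFact (suc x ∷ cs)            ≡⟨ F*Π≡ ⟩
  suc (x + sum cs) * (x + sum cs) !    ≡⟨ cong (suc (x + sum cs) *_) [x+Σ]!≡ ⟩
  suc (x + sum cs) * (m * D)           ≡⟨ swap (suc (x + sum cs)) m D ⟩
  m * suc (x + sum cs) * D             ∎))
  where
  open ≡-Reasoning
  D = prodFact (x ∷ cs)
  regroup : ∀ a F f r → a * F * (f * r) ≡ F * (a * f * r)
  regroup = solve-∀
  swap : ∀ a m d → a * (m * d) ≡ m * a * d
  swap = solve-∀

∈⇒rotation : ∀ {k c} {cs : Vec ℕ (suc k)} → c ∈ cs →
             ∃ λ (rest : Vec ℕ k) → sum cs ≡ c + sum rest × prodFact cs ≡ c ! * prodFact rest
∈⇒rotation {cs = _ ∷ rest} (here refl) = rest , refl , refl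
∈⇒rotation {suc k} {c} {d ∷ cs} (there c∈cs) with ∈⇒rotation c∈cs
... | rest , Σ≡ , Π≡ = d ∷ rest ,
  trans (cong (d +_) Σ≡) (leftComm d c (sum rest)) ,
  trans (cong (d ! *_) Π≡) (*-leftComm (d !) (c !) (prodFact rest))
  where
  leftComm : ∀ a b r → a + (b + r) ≡ b + (a + r)
  leftComm = solve-∀
  *-leftComm : ∀ a b r → a * (b * r) ≡ b * (a * r)
  *-leftComm = solve-∀

sum∣part*multinomial : ∀ {N k c} {cs : Vec ℕ k} → IsDecomposition N cs → c ∈ cs →
                       N ∣ c * multinomial N cs
sum∣part*multinomial {N} {c = c} {cs = cs@(_ ∷ _)} (pos , Σ≡N) c∈cs with ∈⇒rotation c∈cs
... | rest , Σ≡ , Π≡ = subst (_∣ c * multinomial N cs) c+Σ≡N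
  (sum∣head*cofactor rest (All.lookup pos c∈cs) (begin
    multinomial N cs * (c ! * prodFact rest) ≡⟨ cong (multinomial N cs *_) Π≡ ⟨
    multinomial N cs * prodFact cs           ≡⟨ multinomial*prodFact cs Σ≡N ⟩
    N !                                      ≡⟨ cong _! c+Σ≡N ⟨
    (c + sum rest) !                         ∎))
  where
  open ≡-Reasoning
  c+Σ≡N : c + sum rest ≡ N
  c+Σ≡N = trans (sym Σ≡) Σ≡N

primeDivisor : ∀ n → 1 < n → ∃[ q ] (Prime q × q ∣ n)
primeDivisor 1 (s≤s ())
primeDivisor n@(2+ m) _ with factorise n
... | record { factors = [] ; isFactorisation = () }
... | record { factors = q ∷ qs ; isFactorisation = n≡ ; factorsPrime = q-prime ∷ _ } =
  q , q-prime , subst (q ∣_) (sym n≡) (m∣m*n (product qs))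

noCommonPrime⇒coprime : ∀ {m n} .{{_ : NonZero m}} → (∀ q → Prime q → q ∣ m → ¬ q ∣ n) → Coprime m n
noCommonPrime⇒coprime {m} _ {zero}   (0∣m , _)   = contradiction (0∣⇒≡0 0∣m) (≢-nonZero⁻¹ m)
noCommonPrime⇒coprime     _ {1}      _           = refl
noCommonPrime⇒coprime     h {d@(2+ _)} (d∣m , d∣n) with primeDivisor d (s≤s (s≤s z≤n))
... | q , q-prime , q∣d = contradiction (∣-trans q∣d d∣n) (h q q-prime (∣-trans q∣d d∣m))

divisorAcceptable⇒∣parts : ∀ {q N k} {cs : Vec ℕ k} → Prime q → q ∣ N → IsDecomposition N cs →
                           Acceptable q N cs → All (q ∣_) cs
divisorAcceptable⇒∣parts {q} {cs = cs} q-prime q∣N dec acc = lookup⁻ λ i → ∣part (∈-lookup i cs)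
  where
  ∣part : ∀ {c} → c ∈ cs → q ∣ c
  ∣part c∈cs = fromInj₁ (λ q∣M → contradiction q∣M acc)
    (euclidsLemma _ _ q-prime (∣-trans q∣N (sum∣part*multinomial dec c∈cs)))

¬acceptable-at-all-divisors : ∀ {N k x y} {cs : Vec ℕ k} → IsDecomposition N (x ∷ y ∷ cs) →
                              ¬ (∀ q → Prime q → q ∣ N → Acceptable q N (x ∷ y ∷ cs))
¬acceptable-at-all-divisors {N} {x = x} {y} {cs} dec@(1≤x ∷ 1≤y ∷ _ , Σ≡N) all-acc =
  <⇒≱ x<N (∣⇒≤ {{>-nonZero 1≤x}} N∣x)
  where
  x<N : x < N
  x<N = subst (x <_) Σ≡N (<-≤-trans (m<m+n x 1≤y) (+-monoʳ-≤ x (m≤m+n y (sum cs))))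
  instance
    N-nonZero : NonZero N
    N-nonZero = >-nonZero (≤-<-trans z≤n x<N)
  M = multinomial N (x ∷ y ∷ cs)
  N∣x : N ∣ x
  N∣x = coprime-divisor (noCommonPrime⇒coprime all-acc)
          (subst (N ∣_) (*-comm x M) (sum∣part*multinomial dec (here refl)))

prime∣prime^⇒≡ : ∀ {q p} j → Prime q → Prime p → q ∣ p ^ j → q ≡ p
prime∣prime^⇒≡ zero q-prime _ q∣1 = contradiction (subst Prime (∣1⇒≡1 q∣1) q-prime) ¬prime[1]
prime∣prime^⇒≡ (suc j) q-prime p-prime q∣p^[1+j] with euclidsLemma _ _ q-prime q∣p^[1+j]
... | inj₂ q∣p^j = prime∣prime^⇒≡ j q-prime p-prime q∣p^j
... | inj₁ q∣p   = fromInj₂ (λ q≡1 → contradiction (subst Prime q≡1 q-prime) ¬prime[1])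
                     (prime⇒irreducible p-prime q∣p)

sum<2*length⇒any≡1 : ∀ {k} {xs : Vec ℕ k} → All (1 ≤_) xs → sum xs < 2 * k → Any (_≡ 1) xs
sum<2*length⇒any≡1 {suc k} {x ∷ xs} (1≤x ∷ 1≤xs) Σ< with x ≤? 1
... | yes x≤1 = here (≤-antisym x≤1 1≤x)
... | no  x≰1 = there (sum<2*length⇒any≡1 1≤xs (≤-pred (≤-pred (begin
  suc (2 + sum xs)   ≤⟨ s≤s (+-monoˡ-≤ (sum xs) (≰⇒> x≰1)) ⟩
  suc (x + sum xs)   ≤⟨ Σ< ⟩
  2 * suc k          ≡⟨ *-suc 2 k ⟩
  2 + 2 * k          ∎))))
  where open ≤-Reasoning

Blocked : ℕ → ∀ {k} → Vec ℕ k → Set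
Blocked N cs = ∀ q → Prime q → q ∣ N → ¬ Acceptable q N cs

module _ {p : ℕ} (p-prime : Prime p) where

  private instance
    p-nonTrivial : NonTrivial p
    p-nonTrivial = prime⇒nonTrivial p-prime
    p-nonZero : NonZero p
    p-nonZero = prime⇒nonZero p-prime

  open Legendre p

  p∤1 : ¬ p ∣ 1
  p∤1 p∣1 = nonTrivial⇒≢1 (∣1⇒≡1 p∣1)

  !-nonMultiples : ∀ q r → r < p → ∃[ w ] (¬ p ∣ w × (q * p + r) ! ≡ (q * p) ! * w)
  !-nonMultiples q zero    _   = 1 , p∤1 , trans (cong _! (+-identityʳ (q * p))) (sym (*-identityʳ _))
  !-nonMultiples q (suc r) 1+r<p with !-nonMultiples q r (<⇒≤ 1+r<p)
  ... | w , p∤w , eq = suc (q * p + r) * w , prime∤* p-prime p∤qp+1+r p∤w , (begin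
    (q * p + suc r) !                    ≡⟨ cong _! (+-suc (q * p) r) ⟩
    suc (q * p + r) * (q * p + r) !      ≡⟨ cong (suc (q * p + r) *_) eq ⟩
    suc (q * p + r) * ((q * p) ! * w)    ≡⟨ swap (suc (q * p + r)) ((q * p) !) w ⟩
    (q * p) ! * (suc (q * p + r) * w)    ∎)
    where
    open ≡-Reasoning
    swap : ∀ a b c → a * (b * c) ≡ b * (a * c)
    swap = solve-∀
    p∤qp+1+r : ¬ p ∣ suc (q * p + r)
    p∤qp+1+r p∣ = <⇒≱ 1+r<p (∣⇒≤ (∣m+n∣m⇒∣n (subst (p ∣_) (sym (+-suc (q * p) r)) p∣) (n∣m*n q)))

  !-multiples : ∀ q → ∃[ w ] (¬ p ∣ w × (q * p) ! ≡ p ^ q * q ! * w)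
  !-multiples zero = 1 , p∤1 , refl
  !-multiples (suc q) with !-multiples q | !-nonMultiples q (pred p) (≤-reflexive (suc-pred p))
  ... | w , p∤w , eq | w′ , p∤w′ , eq′ = w * w′ , prime∤* p-prime p∤w p∤w′ , (begin
    (suc q * p) !                              ≡⟨ cong _! next ⟨
    suc (q * p + pred p) * (q * p + pred p) !  ≡⟨ cong₂ _*_ next (trans eq′ (cong (_* w′) eq)) ⟩
    suc q * p * (p ^ q * q ! * w * w′)         ≡⟨ regroup p q (p ^ q) (q !) w w′ ⟩
    p * p ^ q * (suc q * q !) * (w * w′)       ∎)
    where
    open ≡-Reasoning
    next : suc (q * p + pred p) ≡ suc q * p
    next = trans (sym (+-suc (q * p) (pred p))) (trans (cong (q * p +_) (suc-pred p)) (+-comm (q * p) p))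
    regroup : ∀ p q P F w w′ → (1 + q) * p * (P * F * w * w′) ≡ p * P * ((1 + q) * F) * (w * w′)
    regroup = solve-∀

  !-split : ∀ n → ∃[ w ] (¬ p ∣ w × n ! ≡ p ^ (n / p) * (n / p) ! * w)
  !-split n with !-multiples (n / p) | !-nonMultiples (n / p) (n % p) (m%n<n n p)
  ... | w , p∤w , eq | w′ , p∤w′ , eq′ = w * w′ , prime∤* p-prime p∤w p∤w′ , (begin
    n !                                       ≡⟨ cong _! (trans (m≡m%n+[m/n]*n n p) (+-comm (n % p) _)) ⟩
    (n / p * p + n % p) !                     ≡⟨ eq′ ⟩
    (n / p * p) ! * w′                        ≡⟨ cong (_* w′) eq ⟩
    p ^ (n / p) * (n / p) ! * w * w′          ≡⟨ *-assoc (p ^ (n / p) * (n / p) !) w w′ ⟩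
    p ^ (n / p) * (n / p) ! * (w * w′)        ∎)
    where open ≡-Reasoning

  legendreAux-exact : ∀ {n k} → n ≤ k → ExactPower p (legendreAux k n) (n !)
  legendreAux-exact {k = zero} z≤n = exactPower 1 p∤1 refl
  legendreAux-exact {n} {suc k} n≤k with !-split n
  ... | w , p∤w , n!≡ = subst (ExactPower p _) (sym n!≡)
    (exactPower-*-unit p-prime (exactPower-p^* (n / p) (legendreAux-exact (/p≤ n≤k))) p∤w)

  legendre-exact : ∀ n → ExactPower p (legendre n) (n !)
  legendre-exact n = legendreAux-exact {n} ≤-refl

  prodFact-exact : ∀ {k} (cs : Vec ℕ k) → ExactPower p (sum (map legendre cs)) (prodFact cs)
  prodFact-exact []       = exactPower 1 p∤1 refl
  prodFact-exact (c ∷ cs) = exactPower-* p-prime (legendre-exact c) (prodFact-exact cs)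

  acceptable⇒legendre-additive : ∀ {N k} {cs : Vec ℕ k} → sum cs ≡ N → Acceptable p N cs →
                                 legendre N ≡ sum (map legendre cs)
  acceptable⇒legendre-additive {N} {cs = cs} Σ≡N acc = exactPower-unique (legendre-exact N)
    (subst (ExactPower p _) (multinomial*prodFact cs Σ≡N)
      (exactPower-* p-prime (exactPower (multinomial N cs) acc (sym (*-identityˡ _))) (prodFact-exact cs)))

  small-parts⇒¬acceptable : ∀ e {N k} {cs : Vec ℕ k} → sum cs ≡ N → All (_< p ^ suc e) cs →
                            p ^ suc e ≤ N → ¬ Acceptable p N cs
  small-parts⇒¬acceptable e {cs = cs} Σ≡N cs< p^e≤N acc =
    <-irrefl (sym (acceptable⇒legendre-additive {cs = cs} Σ≡N acc))
      (legendre-superadditive-strict e cs cs< p^e≤N (≤-reflexive Σ≡N))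

  acceptable⇒digitSum-additive : ∀ {N k} {cs : Vec ℕ k} → sum cs ≡ N → Acceptable p N cs →
                                 digitSum p N ≡ sum (map (digitSum p) cs)
  acceptable⇒digitSum-additive {N} {cs = cs} Σ≡N acc = +-cancelˡ-≡ ((p ∸ 1) * legendre N) _ _ (begin
    (p ∸ 1) * legendre N + digitSum p N                       ≡⟨ legendre-digitSum N ⟩
    N                                                         ≡⟨ trans (sym Σ≡N) (sum≡legendre+digitSum cs) ⟩
    (p ∸ 1) * sum (map legendre cs) + sum (map (digitSum p) cs)
      ≡⟨ cong (λ l → (p ∸ 1) * l + _) (acceptable⇒legendre-additive {cs = cs} Σ≡N acc) ⟨
    (p ∸ 1) * legendre N + sum (map (digitSum p) cs)          ∎)
    where open ≡-Reasoning

  lowDigitSum⇒blocked : ∀ {N k} {cs : Vec ℕ k} → ¬ p ∣ N → digitSum p N < 2 * k →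
                        IsDecomposition N cs → Acceptable p N cs → Blocked N cs
  lowDigitSum⇒blocked {N} {k} {cs} p∤N ds< dec@(pos , Σ≡N) acc q q-prime q∣N q-acc =
    p∤N (subst (_∣ N) (divides-digitSum≡1⇒≡p (All.lookupAny q∣parts digitSum≡1)) q∣N)
    where
    q∣parts : All (q ∣_) cs
    q∣parts = divisorAcceptable⇒∣parts q-prime q∣N dec q-acc
    digitSum≡1 : Any (λ c → digitSum p c ≡ 1) cs
    digitSum≡1 = Any.map⁻ (sum<2*length⇒any≡1 (map⁺ (All.map digitSum-pos pos))
                   (subst (_< 2 * k) (acceptable⇒digitSum-additive {cs = cs} Σ≡N acc) ds<))
    divides-digitSum≡1⇒≡p : ∀ {c} → q ∣ c × digitSum p c ≡ 1 → q ≡ p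
    divides-digitSum≡1⇒≡p (q∣c , ds≡1) =
      let j , c≡p^j = digitSum≡1⇒power ds≡1 in prime∣prime^⇒≡ j q-prime p-prime (subst (q ∣_) c≡p^j q∣c)

threshold⇒bounded : ∀ {p N k t} {cs : Vec ℕ k} → IsThreshold p N k t →
                    IsDecomposition N cs → Acceptable p N cs → All (_≤ t) cs
threshold⇒bounded {cs = cs} (_ , bounded) dec acc = lookup⁻ λ i → bounded cs dec acc _ (∈-lookup i cs)

module ThreeCover {N k p₀ pₘ : ℕ} (p₀-prime : Prime p₀) (pₘ-prime : Prime pₘ)
  (p₀-blocks : ∀ {cs : Vec ℕ k} → IsDecomposition N cs → Acceptable p₀ N cs → Blocked N cs)
  (excludes-pₘ : ∀ {cs : Vec ℕ k} p → Prime p → p ∣ N ⊎ p ≡ p₀ →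
                 IsDecomposition N cs → Acceptable p N cs → ¬ Acceptable pₘ N cs)
  (never-all : ∀ {cs : Vec ℕ k} → IsDecomposition N cs → ¬ (∀ q → Prime q → q ∣ N → Acceptable q N cs))
  where

  pₘ-blocks : ∀ {cs : Vec ℕ k} → IsDecomposition N cs → Acceptable pₘ N cs → Blocked N cs
  pₘ-blocks dec accₘ q q-prime q∣N acc = excludes-pₘ q q-prime (inj₁ q∣N) dec acc accₘ

  ¬twoCover : ∀ {u v : Vec ℕ k} → IsDecomposition N u → IsDecomposition N v →
              Acceptable pₘ N u ⊎ Acceptable pₘ N v →
              ¬ (∀ q → Prime q → q ∣ N → Acceptable q N u ⊎ Acceptable q N v)
  ¬twoCover du dv (inj₁ uₘ) cover = never-all dv λ q q-prime q∣N →
    fromInj₂ (λ u-acc → contradiction u-acc (pₘ-blocks du uₘ q q-prime q∣N)) (cover q q-prime q∣N)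
  ¬twoCover du dv (inj₂ vₘ) cover = never-all du λ q q-prime q∣N →
    fromInj₁ (λ v-acc → contradiction v-acc (pₘ-blocks dv vₘ q q-prime q∣N)) (cover q q-prime q∣N)

  private
    variable A B C : Set

    without₁ : ¬ A → A ⊎ B ⊎ C → B ⊎ C
    without₁ ¬a = fromInj₂ (λ a → contradiction a ¬a)

    without₂ : ¬ B → A ⊎ B ⊎ C → A ⊎ C
    without₂ ¬b = map₂ (fromInj₂ (λ b → contradiction b ¬b))

    without₃ : ¬ C → A ⊎ B ⊎ C → A ⊎ B
    without₃ ¬c = map₂ (fromInj₁ (λ c → contradiction c ¬c))

  ¬threeCover : ∀ {a b c : Vec ℕ k} → IsDecomposition N a → IsDecomposition N b → IsDecomposition N c →
                ¬ (∀ p → Prime p → Acceptable p N a ⊎ Acceptable p N b ⊎ Acceptable p N c)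
  ¬threeCover da db dc cover with cover p₀ p₀-prime
  ... | inj₁ a₀ = ¬twoCover db dc (without₁ (excludes-pₘ _ p₀-prime (inj₂ refl) da a₀) (cover pₘ pₘ-prime))
                    λ q q-prime q∣N → without₁ (p₀-blocks da a₀ q q-prime q∣N) (cover q q-prime)
  ... | inj₂ (inj₁ b₀) = ¬twoCover da dc (without₂ (excludes-pₘ _ p₀-prime (inj₂ refl) db b₀) (cover pₘ pₘ-prime))
                    λ q q-prime q∣N → without₂ (p₀-blocks db b₀ q q-prime q∣N) (cover q q-prime)
  ... | inj₂ (inj₂ c₀) = ¬twoCover da db (without₃ (excludes-pₘ _ p₀-prime (inj₂ refl) dc c₀) (cover pₘ pₘ-prime))
                    λ q q-prime q∣N → without₃ (p₀-blocks dc c₀ q q-prime q∣N) (cover q q-prime)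

lemma8p4 : (N : ℕ) → 2 ≤ N →
    (pmax d : ℕ) → Prime pmax → 1 ≤ d → pmax ^ d ≤ N →
    (∀ q → IsPrimePower q → q ≤ N → q ≤ pmax ^ d) →
    (p₀ : ℕ) → Prime p₀ → p₀ ≢ pmax → ¬ (p₀ ∣ N) → digitSum p₀ N ≤ 5 →
    (∀ p → Prime p → (p ∣ N ⊎ p ≡ p₀) →
      3 ≤ digitSum p N × (∃[ t ] (IsThreshold p N 3 t × t < pmax ^ d))) →
    ¬ (∃[ a ] ∃[ b ] ∃[ c ]
        (IsDecomposition N {3} a × IsDecomposition N {3} b × IsDecomposition N {3} c ×
         (∀ p → Prime p → Acceptable p N a ⊎ Acceptable p N b ⊎ Acceptable p N c)))
lemma8p4 N _ pmax (suc e) pmax-prime _ pmax^d≤N _ p₀ p₀-prime _ p₀∤N digitSum≤5 thresholds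
         (a , b , c , da , db , dc , cover) =
  ThreeCover.¬threeCover p₀-prime pmax-prime p₀-blocks excludes-pmax never-all da db dc cover
  where
  p₀-blocks : ∀ {cs : Vec ℕ 3} → IsDecomposition N cs → Acceptable p₀ N cs → Blocked N cs
  p₀-blocks = lowDigitSum⇒blocked p₀-prime p₀∤N (s≤s digitSum≤5)
  excludes-pmax : ∀ {cs : Vec ℕ 3} p → Prime p → p ∣ N ⊎ p ≡ p₀ →
                  IsDecomposition N cs → Acceptable p N cs → ¬ Acceptable pmax N cs
  excludes-pmax p p-prime p∈ dec acc with thresholds p p-prime p∈
  ... | _ , t , threshold , t<pmax^d = small-parts⇒¬acceptable pmax-prime e (proj₂ dec)
          (All.map (λ c≤t → ≤-<-trans c≤t t<pmax^d) (threshold⇒bounded threshold dec acc)) pmax^d≤N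
  never-all : ∀ {cs : Vec ℕ 3} → IsDecomposition N cs → ¬ (∀ q → Prime q → q ∣ N → Acceptable q N cs)
  never-all {_ ∷ _ ∷ _ ∷ []} = ¬acceptable-at-all-divisors
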